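{- Let $<$ be a relation on a type $A$. If $a:A$ is $<$-accessible, then the singleton list $[a]$ is $<^L$-accessible.
   Context: Homotopy type theory setting; relations are arbitrary type families. The relation $<^L$ on $\mathsf{List}\,A$ is inductively generated by: if every element $y$ of $k:\mathsf{List}\,A$ satisfies $y<x$, then $(l_1::k::l_3)<^L(l_1::[x]::l_3)$ for all lists $l_1,l_3$. $\mathsf{acc}^<$ is inductively generated by $\mathsf{step}:(\Pi x.(x<a)\to\mathsf{acc}^<(x))\to\mathsf{acc}^<(a)$. -}

module Defs where

open import Level using (Level; _⊔_)
open import Data.List using (List; _++_; [_])
open import Data.List.Relation.Unary.All using (All)

-- The multiset-style extension <ᴸ of a relation < on A to List A:
-- if every element y of k satisfies y < x, then
-- (l₁ ++ k ++ l₃) <ᴸ (l₁ ++ [ x ] ++ l₃)  for all lists l₁ l₃.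
-- (The paper's "::" between lists denotes concatenation.)
data _<ᴸ_ {a r : Level} {A : Set a} {_<_ : A → A → Set r}
  : List A → List A → Set (a ⊔ r) where
  <ᴸ-step : (l₁ k l₃ : List A) (x : A)
          → All (λ y → y < x) k
          → _<ᴸ_ {_<_ = _<_} (l₁ ++ k ++ l₃) (l₁ ++ [ x ] ++ l₃)

ListRel : {a r : Level} {A : Set a} → (A → A → Set r) → List A → List A → Set (a ⊔ r)
ListRel _<_ = _<ᴸ_ {_<_ = _<_}

data acc {a r : Level} {A : Set a} (_<_ : A → A → Set r) : A → Set (a ⊔ r) where
  step : {z : A} → ((x : A) → x < z → acc _<_ x) → acc _<_ z

module Submission where

-- Idea.  Rather than treating the singleton [ x ] directly, we prove the
-- general "cons" step, from which the singleton case follows at once: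
--
--   if x is <-accessible and l is <ᴸ-accessible, then so is x ∷ l,
--
-- by induction on acc x, and inside it on acc l.  Everything <ᴸ-below x ∷ l
-- arises in one of two ways (lemma below-cons): either the head x is replaced
-- by a list k of elements <-below x, giving k ++ l, or the step happens in
-- the tail, giving x ∷ m with m <ᴸ l.  The second case is the inner induction
-- hypothesis; the first follows from the outer one, since prepending the
-- elements of k one at a time preserves accessibility (lemma acc-++).
-- Starting from the empty list, which is trivially accessible because nothing
-- lies below it, the theorem is the case l = [].

open import Defs
open import Level using (Level; _⊔_)
open import Data.List using (List; [_]; []; _∷_; _++_)
open import Data.List.Relation.Unary.All using (All; []; _∷_)
open import Data.Empty using (⊥; ⊥-elim)
open import Relation.Nullary using (¬_)
open import Relation.Binary.PropositionalEquality using (_≡_; refl)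

module _ {a r : Level} {A : Set a} (_<_ : A → A → Set r) where

  private
    _⊏_ : List A → List A → Set (a ⊔ r)
    _⊏_ = ListRel _<_

  -- The empty list is <ᴸ-minimal: every <ᴸ-step has a nonempty right-hand side.
  nothing-below-[] : ∀ {m} → ¬ (m ⊏ [])
  nothing-below-[] m<[] = nonempty m<[] refl
    where
    nonempty : ∀ {m n} → m ⊏ n → n ≡ [] → ⊥
    nonempty (<ᴸ-step [] _ _ _ _) ()
    nonempty (<ᴸ-step (_ ∷ _) _ _ _ _) ()

  acc-[] : acc _⊏_ []
  acc-[] = step λ _ m<[] → ⊥-elim (nothing-below-[] m<[])

  data BelowCons (x : A) (l : List A) : List A → Set (a ⊔ r) where
    replace-head : (k : List A) → All (_< x) k → BelowCons x l (k ++ l)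
    below-tail   : ∀ {m} → m ⊏ l → BelowCons x l (x ∷ m)

  -- Inversion of <ᴸ at a cons: the step either rewrites the head or lies in
  -- the tail, according to whether its prefix l₁ is empty.
  below-cons : ∀ {x l m} → m ⊏ (x ∷ l) → BelowCons x l m
  below-cons m<x∷l = invert m<x∷l refl
    where
    invert : ∀ {x l m n} → m ⊏ n → n ≡ x ∷ l → BelowCons x l m
    invert (<ᴸ-step [] k l₃ x' k<x') refl = replace-head k k<x'
    invert (<ᴸ-step (_ ∷ l₁) k l₃ x' k<x') refl =
      below-tail (<ᴸ-step l₁ k l₃ x' k<x')

  acc-++ : {ℓ : Level} {P : A → Set ℓ}
         → (∀ {y} → P y → ∀ {l} → acc _⊏_ l → acc _⊏_ (y ∷ l))
         → ∀ {k l} → All P k → acc _⊏_ l → acc _⊏_ (k ++ l)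
  acc-++ cons-y []         acc-l = acc-l
  acc-++ cons-y (py ∷ pks) acc-l = cons-y py (acc-++ cons-y pks acc-l)

  acc-∷ : ∀ {x} → acc _<_ x → ∀ {l} → acc _⊏_ l → acc _⊏_ (x ∷ l)
  acc-∷ {x} (step acc-below-x) = inner
    where
    inner : ∀ {l} → acc _⊏_ l → acc _⊏_ (x ∷ l)
    inner {l} acc-l@(step acc-below-l) = step λ _ m<x∷l → from (below-cons m<x∷l)
      where
      from : ∀ {m} → BelowCons x l m → acc _⊏_ m
      from (replace-head k k<x) =
        acc-++ (λ y<x → acc-∷ (acc-below-x _ y<x)) k<x acc-l
      from (below-tail m<l) = inner (acc-below-l _ m<l)

lemma5p4 : {a r : Level} {A : Set a} (_<_ : A → A → Set r) (x : A)
    → acc _<_ x → acc (ListRel _<_) [ x ]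
lemma5p4 _<_ x acc-x = acc-∷ _<_ acc-x (acc-[] _<_)
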